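{- Let $q$ be a power of a prime $p$, $k$ a positive divisor of $q-1$, $e=\frac{q-1}{k}$, $\alpha$ a primitive element of $GF(q)$, $C_a=\langle\alpha^e\rangle\alpha^a$ for integers $a$, and $(a,b)=|C_b\cap(C_a+1)|$ for $0\le a,b<e$. If $\frac{3k}{4}\le p<k$, then $(a,b)\le\lfloor\frac{k}{2}\rfloor$ for all $a,b$ with $0\le a,b<e$.
   Context: $(a,b)$ are the cyclotomic numbers of order $e$ over $GF(q)$; $C_a+1=\{x+1:x\in C_a\}$. -}

module Defs where

open import Level using (0ℓ)
open import Data.Nat using (ℕ; zero; suc; _+_; _*_; _∸_; _≤_; _<_) renaming (_^_ to _^ℕ_)
open import Data.Nat.Primality using (Prime)
open import Data.Nat.Divisibility using (_∣_)
open import Data.Fin using (Fin)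
open import Data.List using (List; length)
open import Data.List.Membership.Propositional using (_∈_)
open import Data.List.Relation.Unary.Unique.Propositional using (Unique)
open import Data.Product using (Σ; ∃; _×_)
open import Function.Bundles using (_↔_; _⇔_)
open import Relation.Nullary using (¬_)
open import Relation.Binary.PropositionalEquality using (_≡_)
open import Relation.Binary.Definitions using (DecidableEquality)
open import Algebra.Structures using (IsCommutativeRing)

record FiniteField (q : ℕ) : Set₁ where
  infixl 6 _+F_
  infixl 7 _*F_
  field
    Carrier : Set
    _+F_ _*F_ : Carrier → Carrier → Carrier
    -F_ : Carrier → Carrier
    0F 1F : Carrier
    isCommutativeRing : IsCommutativeRing _≡_ _+F_ _*F_ -F_ 0F 1F
    0≢1 : ¬ (0F ≡ 1F)
    inverse : ∀ x → ¬ (x ≡ 0F) → ∃ λ y → x *F y ≡ 1F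
    _≟_ : DecidableEquality Carrier
    enum : Fin q ↔ Carrier

  _^F_ : Carrier → ℕ → Carrier
  x ^F zero = 1F
  x ^F suc n = x *F (x ^F n)

  _×1 : ℕ → Carrier
  zero ×1 = 0F
  suc n ×1 = 1F +F (n ×1)

  IsPrimitive : Carrier → Set
  IsPrimitive α = ¬ (α ≡ 0F) × (∀ x → ¬ (x ≡ 0F) → ∃ λ i → α ^F i ≡ x)

  InC : (α : Carrier) (e a : ℕ) → Carrier → Set
  InC α e a x = ∃ λ j → x ≡ ((α ^F e) ^F j) *F (α ^F a)

  InCplus1 : (α : Carrier) (e a : ℕ) → Carrier → Set
  InCplus1 α e a x = ∃ λ y → InC α e a y × x ≡ y +F 1F

  HasSize : (Carrier → Set) → ℕ → Set
  HasSize P n = Σ (List Carrier) λ xs → Unique xs × length xs ≡ n × (∀ x → (x ∈ xs) ⇔ P x)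

  CyclotomicNumber : (α : Carrier) (e a b n : ℕ) → Set
  CyclotomicNumber α e a b n = HasSize (λ x → InC α e b x × InCplus1 α e a x) n

module Submission where

open import Defs
open import Data.Nat using (ℕ; _+_; _*_; _∸_; _≤_; _<_; _^_; _/_)
open import Data.Nat.Primality using (Prime)
open import Data.Nat.Divisibility using (_∣_)
open import Data.Product using (∃; _×_)
open import Relation.Binary.PropositionalEquality using (_≡_)

open import Level using (0ℓ)
open import Algebra.Bundles using (CommutativeRing)
import Algebra.Properties.CommutativeSemiring.Binomial as Binomial
import Algebra.Properties.CommutativeSemiring.Exp as CommutativeSemiringExp
import Algebra.Properties.CommutativeSemigroup as CommutativeSemigroupProperties
import Algebra.Properties.Monoid.Sum as MonoidSum
import Algebra.Properties.Ring as RingProperties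
import Algebra.Properties.Semiring.Exp as SemiringExp
import Algebra.Properties.Semiring.Mult as SemiringMult
import Algebra.Solver.Ring as RingSolver
import Algebra.Solver.Ring.AlmostCommutativeRing as ACR
open import Data.Empty using (⊥-elim)
open import Data.Fin as Fin using (Fin; toℕ; inject₁; fromℕ)
open import Data.Fin.Properties using (toℕ-inject₁; toℕ<n; toℕ-fromℕ)
open import Data.Integer as ℤ using (ℤ; -[1+_])
import Data.Integer.Properties as ℤ
open import Data.List using (List; []; _∷_; length; map; filter; foldr; allFin)
open import Data.List.Properties using (length-map; length-tabulate)
open import Data.List.Membership.Propositional using (_∈_)
open import Data.List.Membership.Propositional.Properties
  using (∈-map⁺; ∈-map⁻; ∈-filter⁺; ∈-filter⁻; ∈-allFin)
open import Data.List.Membership.Propositional.Properties.WithK using (unique∧set⇒bag)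
open import Data.List.Relation.Binary.BagAndSetEquality using (∼bag⇒↭)
open import Data.List.Relation.Binary.Permutation.Propositional using (_↭_; ↭⇒↭ₛ)
open import Data.List.Relation.Binary.Permutation.Propositional.Properties using (↭-length)
import Data.List.Relation.Binary.Permutation.Setoid.Properties as PermutationProperties
open import Data.List.Relation.Unary.All as All using (All)
open import Data.List.Relation.Unary.AllPairs using (_∷_)
open import Data.List.Relation.Unary.Any using (here; there)
open import Data.List.Relation.Unary.Unique.Propositional using (Unique)
import Data.List.Relation.Unary.Unique.Propositional.Properties as Unique
open import Data.Maybe using (Maybe; just; nothing)
open import Data.Nat using (zero; suc; z≤n; s≤s)
import Data.Nat.Properties as ℕ
open import Data.Nat.Combinatorics using (_C_; nC1≡n; nCn≡1; nCk+nC[k+1]≡[n+1]C[k+1])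
open import Data.Nat.Combinatorics.Specification using (k>n⇒nCk≡0)
open import Data.Nat.Divisibility using (divides; ∣⇒≤)
open import Data.Nat.DivMod using (m*n/n≡m; /-monoˡ-≤)
open import Data.Nat.Primality using (euclidsLemma; ¬prime[0])
open import Data.Nat.Solver using (module +-*-Solver)
open import Data.Product using (Σ-syntax; _,_; proj₁; proj₂)
open import Data.Sign as Sign using (Sign)
open import Data.Sum using (inj₁; inj₂)
open import Function.Bundles using (Inverse; Injection; Equivalence; mk⇔)
open import Function.Properties.Inverse using (↔⇒↣)
open import Relation.Binary.PropositionalEquality
  using (refl; sym; trans; cong; cong₂; subst; subst₂; _≗_; setoid; module ≡-Reasoning)
open import Relation.Nullary using (¬_; ¬?; yes; no)

-- For x ∈ C_b ∩ (C_a + 1) we have x^k = α^(bk) =: d and (x − 1)^k = α^(ak) =: c, because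
-- (α^e)^k = α^(q−1) = 1.  Write k = p + r.  The Frobenius map gives (x − 1)^p = x^p − 1, so
-- x^p x^r = d and (x^p − 1)(x − 1)^r = c; multiplying the latter by x^r and substituting the
-- former eliminates x^p:
--   x^r (x − 1)^r + c x^r − d (x − 1)^r = 0.
-- This monic equation of degree 2r has at most 2r solutions, and 3k ≤ 4p says 3r ≤ p,
-- i.e. 2r ≤ k/2.

[1+k]*[1+n]C[1+k]≡[1+n]*nCk : ∀ n k → suc k * (suc n C suc k) ≡ suc n * (n C k)
[1+k]*[1+n]C[1+k]≡[1+n]*nCk zero zero = refl
[1+k]*[1+n]C[1+k]≡[1+n]*nCk zero (suc k) = begin
  suc (suc k) * (1 C suc (suc k)) ≡⟨ cong (suc (suc k) *_) (k>n⇒nCk≡0 {1} {suc (suc k)} (s≤s (s≤s z≤n))) ⟩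
  suc (suc k) * 0                 ≡⟨ ℕ.*-zeroʳ (suc (suc k)) ⟩
  0                               ≡⟨ cong (1 *_) (k>n⇒nCk≡0 {0} {suc k} (s≤s z≤n)) ⟨
  1 * (0 C suc k)                 ∎
  where open ≡-Reasoning
[1+k]*[1+n]C[1+k]≡[1+n]*nCk (suc n) zero =
  trans (ℕ.+-identityʳ _) (trans (nC1≡n (suc (suc n))) (sym (ℕ.*-identityʳ (suc (suc n)))))
[1+k]*[1+n]C[1+k]≡[1+n]*nCk (suc n) (suc k) = begin
  suc (suc k) * (suc (suc n) C suc (suc k))
    ≡⟨ cong (suc (suc k) *_) (nCk+nC[k+1]≡[n+1]C[k+1] (suc n) (suc k)) ⟨
  suc (suc k) * (A + B)
    ≡⟨ solve 3 (λ k A B → (con 2 :+ k) :* (A :+ B) := A :+ ((con 1 :+ k) :* A :+ (con 2 :+ k) :* B))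
               refl k A B ⟩
  A + (suc k * A + suc (suc k) * B)
    ≡⟨ cong (A +_) (cong₂ _+_ ([1+k]*[1+n]C[1+k]≡[1+n]*nCk n k) ([1+k]*[1+n]C[1+k]≡[1+n]*nCk n (suc k))) ⟩
  A + (suc n * (n C k) + suc n * (n C suc k))
    ≡⟨ cong (A +_) (ℕ.*-distribˡ-+ (suc n) (n C k) (n C suc k)) ⟨
  A + suc n * (n C k + n C suc k)
    ≡⟨ cong (λ z → A + suc n * z) (nCk+nC[k+1]≡[n+1]C[k+1] n k) ⟩
  suc (suc n) * A ∎
  where
  open ≡-Reasoning
  open +-*-Solver
  A B : ℕ
  A = suc n C suc k
  B = suc n C suc (suc k)

prime∣pCk : ∀ {p k} → Prime p → 0 < k → k < p → p ∣ p C k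
-- k · C(p, k) = p · C(p − 1, k − 1), and p ∤ k.
prime∣pCk {suc n} {suc k} p-prime _ k<p
  with euclidsLemma (suc k) (suc n C suc k) p-prime
         (divides (n C k) (trans ([1+k]*[1+n]C[1+k]≡[1+n]*nCk n k) (ℕ.*-comm (suc n) (n C k))))
... | inj₁ p∣k   = ⊥-elim (ℕ.<⇒≱ k<p (∣⇒≤ p∣k))
... | inj₂ p∣pCk = p∣pCk

[k∸p]+[k∸p]≤k/2 : ∀ {p k} → 3 * k ≤ 4 * p → p < k → (k ∸ p) + (k ∸ p) ≤ k / 2
[k∸p]+[k∸p]≤k/2 {p} {k} 3k≤4p p<k =
  ℕ.≤-trans (ℕ.≤-reflexive (sym (m*n/n≡m (r + r) 2))) (/-monoˡ-≤ 2 [r+r]*2≤k)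
  where
  open +-*-Solver
  r : ℕ
  r = k ∸ p
  p+r≡k : p + r ≡ k
  p+r≡k = ℕ.m+[n∸m]≡n (ℕ.<⇒≤ p<k)
  3r≤p : 3 * r ≤ p
  3r≤p = ℕ.+-cancelˡ-≤ (3 * p) _ _ (subst₂ _≤_
    (trans (cong (3 *_) (sym p+r≡k)) (solve 2 (λ p r → con 3 :* (p :+ r) := con 3 :* p :+ con 3 :* r) refl p r))
    (solve 1 (λ p → con 4 :* p := con 3 :* p :+ p) refl p) 3k≤4p)
  [r+r]*2≤k : (r + r) * 2 ≤ k
  [r+r]*2≤k = subst₂ _≤_ (solve 1 (λ r → con 3 :* r :+ r := (r :+ r) :* con 2) refl r) p+r≡k
    (ℕ.+-monoˡ-≤ r 3r≤p)

module FiniteFieldProperties {q : ℕ} (F : FiniteField q) where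

  open FiniteField F

  commutativeRing : CommutativeRing 0ℓ 0ℓ
  commutativeRing = record { isCommutativeRing = isCommutativeRing }

  open CommutativeRing commutativeRing
    using (+-comm; +-assoc; +-identityˡ; +-identityʳ; *-assoc; *-identityˡ; *-identityʳ; zeroˡ; zeroʳ;
           -‿inverseʳ; ring; semiring; commutativeSemiring; +-monoid; *-commutativeSemigroup;
           *-isCommutativeMonoid)
  open RingProperties ring using (-‿involutive; -‿anti-homo-+; -0#≈0#; -1*x≈-x)
  open SemiringMult semiring using () renaming (_×_ to _·_)
  private module Mult = SemiringMult semiring
  open ≡-Reasoning

  infixl 6 _-F_
  _-F_ : Carrier → Carrier → Carrier
  x -F y = x +F -F y

  x+y-y≡x : ∀ x y → (x +F y) -F y ≡ x
  x+y-y≡x x y = trans (+-assoc x y (-F y)) (trans (cong (x +F_) (-‿inverseʳ y)) (+-identityʳ x))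

  -- The ring solver needs coefficients whose equality is decided by computation, so it is
  -- run with ℤ-coefficients, interpreted in F by fromℤ.

  ×1≗·1F : ∀ n → n ×1 ≡ n · 1F
  ×1≗·1F zero    = refl
  ×1≗·1F (suc n) = cong (1F +F_) (×1≗·1F n)

  ×1-homo-+ : ∀ m n → (m + n) ×1 ≡ m ×1 +F n ×1
  ×1-homo-+ m n = begin
    (m + n) ×1         ≡⟨ ×1≗·1F (m + n) ⟩
    (m + n) · 1F       ≡⟨ Mult.×-homo-+ 1F m n ⟩
    m · 1F +F n · 1F   ≡⟨ cong₂ _+F_ (×1≗·1F m) (×1≗·1F n) ⟨
    m ×1 +F n ×1       ∎

  ×1-homo-* : ∀ m n → (m * n) ×1 ≡ m ×1 *F n ×1
  ×1-homo-* m n = begin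
    (m * n) ×1         ≡⟨ ×1≗·1F (m * n) ⟩
    (m * n) · 1F       ≡⟨ Mult.×1-homo-* m n ⟩
    m · 1F *F n · 1F   ≡⟨ cong₂ _*F_ (×1≗·1F m) (×1≗·1F n) ⟨
    m ×1 *F n ×1       ∎

  fromℤ : ℤ → Carrier
  fromℤ (ℤ.+ n)  = n ×1
  fromℤ -[1+ n ] = -F (suc n ×1)

  fromℤ-homo-neg : ∀ i → fromℤ (ℤ.- i) ≡ -F fromℤ i
  fromℤ-homo-neg -[1+ n ]    = sym (-‿involutive _)
  fromℤ-homo-neg (ℤ.+ zero)  = sym -0#≈0#
  fromℤ-homo-neg (ℤ.+ suc n) = refl

  fromℤ-⊖ : ∀ m n → fromℤ (m ℤ.⊖ n) ≡ m ×1 -F n ×1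
  fromℤ-⊖ m n with ℕ.≤-<-connex n m
  ... | inj₁ n≤m = begin
    fromℤ (m ℤ.⊖ n)                   ≡⟨ cong fromℤ (ℤ.⊖-≥ n≤m) ⟩
    (m ∸ n) ×1                        ≡⟨ x+y-y≡x ((m ∸ n) ×1) (n ×1) ⟨
    ((m ∸ n) ×1 +F n ×1) -F n ×1      ≡⟨ cong (_-F n ×1) (×1-homo-+ (m ∸ n) n) ⟨
    ((m ∸ n) + n) ×1 -F n ×1          ≡⟨ cong (λ k → k ×1 -F n ×1) (ℕ.m∸n+n≡m n≤m) ⟩
    m ×1 -F n ×1                      ∎
  ... | inj₂ m<n = begin
    fromℤ (m ℤ.⊖ n)                   ≡⟨ cong fromℤ (ℤ.⊖-< m<n) ⟩
    fromℤ (ℤ.- (ℤ.+ (n ∸ m)))         ≡⟨ fromℤ-homo-neg (ℤ.+ (n ∸ m)) ⟩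
    -F ((n ∸ m) ×1)                   ≡⟨ v-[u+v]≡-u ((n ∸ m) ×1) (m ×1) ⟨
    m ×1 -F ((n ∸ m) ×1 +F m ×1)      ≡⟨ cong (m ×1 -F_) (×1-homo-+ (n ∸ m) m) ⟨
    m ×1 -F ((n ∸ m) + m) ×1          ≡⟨ cong (λ k → m ×1 -F k ×1) (ℕ.m∸n+n≡m (ℕ.<⇒≤ m<n)) ⟩
    m ×1 -F n ×1                      ∎
    where
    v-[u+v]≡-u : ∀ u v → v -F (u +F v) ≡ -F u
    v-[u+v]≡-u u v = begin
      v +F -F (u +F v)       ≡⟨ cong (v +F_) (-‿anti-homo-+ u v) ⟩
      v +F (-F v +F -F u)    ≡⟨ +-assoc v (-F v) (-F u) ⟨
      (v +F -F v) +F -F u    ≡⟨ cong (_+F -F u) (-‿inverseʳ v) ⟩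
      0F +F -F u             ≡⟨ +-identityˡ _ ⟩
      -F u                   ∎

  fromℤ-homo-+ : ∀ i j → fromℤ (i ℤ.+ j) ≡ fromℤ i +F fromℤ j
  fromℤ-homo-+ -[1+ m ] -[1+ n ] = begin
    -F (suc (suc (m + n)) ×1)          ≡⟨ cong (λ k → -F (suc k ×1)) (ℕ.+-suc m n) ⟨
    -F ((suc m + suc n) ×1)            ≡⟨ cong -F_ (×1-homo-+ (suc m) (suc n)) ⟩
    -F (suc m ×1 +F suc n ×1)          ≡⟨ -‿anti-homo-+ _ _ ⟩
    -F (suc n ×1) +F -F (suc m ×1)     ≡⟨ +-comm _ _ ⟩
    -F (suc m ×1) +F -F (suc n ×1)     ∎
  fromℤ-homo-+ -[1+ m ] (ℤ.+ n)  = trans (fromℤ-⊖ n (suc m)) (+-comm _ _)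
  fromℤ-homo-+ (ℤ.+ m)  -[1+ n ] = fromℤ-⊖ m (suc n)
  fromℤ-homo-+ (ℤ.+ m)  (ℤ.+ n)  = ×1-homo-+ m n

  fromSign : Sign → Carrier
  fromSign Sign.+ = 1F
  fromSign Sign.- = -F 1F

  fromSign-homo-* : ∀ s t → fromSign (s Sign.* t) ≡ fromSign s *F fromSign t
  fromSign-homo-* Sign.+ t      = sym (*-identityˡ _)
  fromSign-homo-* Sign.- Sign.+ = sym (*-identityʳ _)
  fromSign-homo-* Sign.- Sign.- = sym (trans (-1*x≈-x (-F 1F)) (-‿involutive 1F))

  fromℤ-◃ : ∀ s n → fromℤ (s ℤ.◃ n) ≡ fromSign s *F n ×1
  fromℤ-◃ s      zero    = sym (zeroʳ (fromSign s))
  fromℤ-◃ Sign.+ (suc n) = sym (*-identityˡ _)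
  fromℤ-◃ Sign.- (suc n) = sym (-1*x≈-x _)

  fromℤ-homo-* : ∀ i j → fromℤ (i ℤ.* j) ≡ fromℤ i *F fromℤ j
  fromℤ-homo-* i j = begin
    fromℤ (i ℤ.* j)
      ≡⟨ fromℤ-◃ (ℤ.sign i Sign.* ℤ.sign j) (ℤ.∣ i ∣ * ℤ.∣ j ∣) ⟩
    fromSign (ℤ.sign i Sign.* ℤ.sign j) *F (ℤ.∣ i ∣ * ℤ.∣ j ∣) ×1
      ≡⟨ cong₂ _*F_ (fromSign-homo-* (ℤ.sign i) (ℤ.sign j)) (×1-homo-* ℤ.∣ i ∣ ℤ.∣ j ∣) ⟩
    (fromSign (ℤ.sign i) *F fromSign (ℤ.sign j)) *F (ℤ.∣ i ∣ ×1 *F ℤ.∣ j ∣ ×1)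
      ≡⟨ interchange _ _ _ _ ⟩
    (fromSign (ℤ.sign i) *F ℤ.∣ i ∣ ×1) *F (fromSign (ℤ.sign j) *F ℤ.∣ j ∣ ×1)
      ≡⟨ cong₂ _*F_ (fromℤ-sign-abs i) (fromℤ-sign-abs j) ⟨
    fromℤ i *F fromℤ j ∎
    where
    open CommutativeSemigroupProperties *-commutativeSemigroup using (interchange)
    fromℤ-sign-abs : ∀ i → fromℤ i ≡ fromSign (ℤ.sign i) *F ℤ.∣ i ∣ ×1
    fromℤ-sign-abs i = trans (cong fromℤ (sym (ℤ.◃-inverse i))) (fromℤ-◃ (ℤ.sign i) ℤ.∣ i ∣)

  fromℤ-morphism : ACR._-Raw-AlmostCommutative⟶_ (CommutativeRing.rawRing ℤ.+-*-commutativeRing)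
                                                  (ACR.fromCommutativeRing commutativeRing)
  fromℤ-morphism = record
    { ⟦_⟧ = fromℤ ; +-homo = fromℤ-homo-+ ; *-homo = fromℤ-homo-* ; -‿homo = fromℤ-homo-neg
    ; 0-homo = refl ; 1-homo = +-identityʳ 1F }

  fromℤ-≟ : ∀ i j → Maybe (fromℤ i ≡ fromℤ j)
  fromℤ-≟ i j with i ℤ.≟ j
  ... | yes i≡j = just (cong fromℤ i≡j)
  ... | no _    = nothing

  open RingSolver (CommutativeRing.rawRing ℤ.+-*-commutativeRing)
    (ACR.fromCommutativeRing commutativeRing) fromℤ-morphism fromℤ-≟
    using (solve; _:+_; _:*_; _:-_; :-_; _:=_)

  x-y≡0⇒x≡y : ∀ {x y} → x -F y ≡ 0F → x ≡ y
  x-y≡0⇒x≡y {x} {y} x-y≡0 = begin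
    x              ≡⟨ solve 2 (λ x y → x := (x :- y) :+ y) refl x y ⟩
    (x -F y) +F y  ≡⟨ cong (_+F y) x-y≡0 ⟩
    0F +F y        ≡⟨ +-identityˡ y ⟩
    y              ∎

  x≢0∧x*y≡0⇒y≡0 : ∀ {x y} → ¬ x ≡ 0F → x *F y ≡ 0F → y ≡ 0F
  x≢0∧x*y≡0⇒y≡0 {x} {y} x≢0 xy≡0 with inverse x x≢0
  ... | x⁻¹ , xx⁻¹≡1 = begin
    y                 ≡⟨ *-identityˡ y ⟨
    1F *F y           ≡⟨ cong (_*F y) xx⁻¹≡1 ⟨
    (x *F x⁻¹) *F y   ≡⟨ solve 3 (λ x x⁻¹ y → (x :* x⁻¹) :* y := x⁻¹ :* (x :* y)) refl x x⁻¹ y ⟩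
    x⁻¹ *F (x *F y)   ≡⟨ cong (x⁻¹ *F_) xy≡0 ⟩
    x⁻¹ *F 0F         ≡⟨ zeroʳ x⁻¹ ⟩
    0F                ∎

  open SemiringExp semiring using (^-homo-*; ^-assocʳ) renaming (_^_ to _^′_)
  open CommutativeSemiringExp commutativeSemiring using (^-distrib-*)

  ^F≗^′ : ∀ x n → x ^F n ≡ x ^′ n
  ^F≗^′ x zero    = refl
  ^F≗^′ x (suc n) = cong (x *F_) (^F≗^′ x n)

  ^F-homo-* : ∀ x m n → x ^F (m + n) ≡ x ^F m *F x ^F n
  ^F-homo-* x m n = begin
    x ^F (m + n)        ≡⟨ ^F≗^′ x (m + n) ⟩
    x ^′ (m + n)        ≡⟨ ^-homo-* x m n ⟩
    x ^′ m *F x ^′ n    ≡⟨ cong₂ _*F_ (^F≗^′ x m) (^F≗^′ x n) ⟨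
    x ^F m *F x ^F n    ∎

  ^F-assocʳ : ∀ x m n → (x ^F m) ^F n ≡ x ^F (m * n)
  ^F-assocʳ x m n = begin
    (x ^F m) ^F n  ≡⟨ ^F≗^′ (x ^F m) n ⟩
    (x ^F m) ^′ n  ≡⟨ cong (_^′ n) (^F≗^′ x m) ⟩
    (x ^′ m) ^′ n  ≡⟨ ^-assocʳ x m n ⟩
    x ^′ (m * n)   ≡⟨ ^F≗^′ x (m * n) ⟨
    x ^F (m * n)   ∎

  ^F-distrib-* : ∀ x y n → (x *F y) ^F n ≡ x ^F n *F y ^F n
  ^F-distrib-* x y n = begin
    (x *F y) ^F n     ≡⟨ ^F≗^′ (x *F y) n ⟩
    (x *F y) ^′ n     ≡⟨ ^-distrib-* x y n ⟩
    x ^′ n *F y ^′ n  ≡⟨ cong₂ _*F_ (^F≗^′ x n) (^F≗^′ y n) ⟨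
    x ^F n *F y ^F n  ∎

  1^F : ∀ n → 1F ^F n ≡ 1F
  1^F zero    = refl
  1^F (suc n) = trans (*-identityˡ _) (1^F n)

  -- Polynomial functions and their roots

  eval : List Carrier → Carrier → Carrier → Carrier
  eval []       l x = l
  eval (c ∷ cs) l x = c +F x *F eval cs l x

  -- f is a polynomial function of formal degree n whose coefficient of xⁿ is l
  -- (l may be 0, so this only bounds the degree by n).
  IsPolynomial : ℕ → Carrier → (Carrier → Carrier) → Set
  IsPolynomial n l f = Σ[ cs ∈ List Carrier ] length cs ≡ n × (∀ x → eval cs l x ≡ f x)

  private
    variable
      n : ℕ
      l : Carrier
      f g : Carrier → Carrier

  eval-isPolynomial : ∀ cs → IsPolynomial (length cs) l (eval cs l)
  eval-isPolynomial cs = cs , refl , λ _ → refl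

  isPolynomial-resp : f ≗ g → IsPolynomial n l f → IsPolynomial n l g
  isPolynomial-resp f≗g (cs , len , eval≗f) = cs , len , λ x → trans (eval≗f x) (f≗g x)

  ∷-isPolynomial : ∀ c → IsPolynomial n l f → IsPolynomial (suc n) l (λ x → c +F x *F f x)
  ∷-isPolynomial c (cs , len , eval≗f) = c ∷ cs , cong suc len , λ x → cong (λ y → c +F x *F y) (eval≗f x)

  +-const-isPolynomial : ∀ c → IsPolynomial (suc n) l f → IsPolynomial (suc n) l (λ x → c +F f x)
  +-const-isPolynomial c (d ∷ cs , len , eval≗f) =
    (c +F d) ∷ cs , len , λ x → trans (+-assoc c d _) (cong (c +F_) (eval≗f x))

  raise-eval : ∀ cs → IsPolynomial (suc (length cs)) 0F (eval cs l)
  raise-eval {l = l} [] = l ∷ [] , refl , λ x → trans (cong (l +F_) (zeroʳ x)) (+-identityʳ l)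
  raise-eval (c ∷ cs)  = ∷-isPolynomial c (raise-eval cs)

  raise-isPolynomial : IsPolynomial n l f → IsPolynomial (suc n) 0F f
  raise-isPolynomial (cs , refl , eval≗f) = isPolynomial-resp eval≗f (raise-eval cs)

  raise-<-isPolynomial : ∀ {m} → m < n → IsPolynomial m l f → IsPolynomial n 0F f
  raise-<-isPolynomial {n = suc n} m<1+n poly with ℕ.m<1+n⇒m<n∨m≡n m<1+n
  ... | inj₁ m<n  = raise-isPolynomial (raise-<-isPolynomial m<n poly)
  ... | inj₂ refl = raise-isPolynomial poly

  *-linear-eval : ∀ b cs → IsPolynomial (suc (length cs)) l (λ x → (x +F b) *F eval cs l x)
  *-linear-eval {l = l} b [] = (b *F l) ∷ [] , refl , λ x →
    solve 3 (λ b l x → b :* l :+ x :* l := (x :+ b) :* l) refl b l x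
  *-linear-eval {l = l} b (c ∷ cs) = isPolynomial-resp expand
    (∷-isPolynomial (b *F c) (+-const-isPolynomial c (*-linear-eval b cs)))
    where
    expand : ∀ x → b *F c +F x *F (c +F (x +F b) *F eval cs l x) ≡ (x +F b) *F eval (c ∷ cs) l x
    expand x = solve 4 (λ b c x e → b :* c :+ x :* (c :+ (x :+ b) :* e) := (x :+ b) :* (c :+ x :* e))
      refl b c x (eval cs l x)

  *-linear-isPolynomial : ∀ b → IsPolynomial n l f → IsPolynomial (suc n) l (λ x → (x +F b) *F f x)
  *-linear-isPolynomial b (cs , refl , eval≗f) =
    isPolynomial-resp (λ x → cong ((x +F b) *F_) (eval≗f x)) (*-linear-eval b cs)

  *-linear^-isPolynomial : ∀ r b → IsPolynomial n l f → IsPolynomial (r + n) l (λ x → (x +F b) ^F r *F f x)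
  *-linear^-isPolynomial zero    b poly = isPolynomial-resp (λ x → sym (*-identityˡ _)) poly
  *-linear^-isPolynomial (suc r) b poly = isPolynomial-resp (λ x → sym (*-assoc _ _ _))
    (*-linear-isPolynomial b (*-linear^-isPolynomial r b poly))

  +-eval : ∀ {l′} cs ds → length cs ≡ length ds →
           IsPolynomial (length cs) (l +F l′) (λ x → eval cs l x +F eval ds l′ x)
  +-eval [] [] _ = [] , refl , λ _ → refl
  +-eval {l = l} {l′} (c ∷ cs) (d ∷ ds) len = isPolynomial-resp expand
    (∷-isPolynomial (c +F d) (+-eval cs ds (ℕ.suc-injective len)))
    where
    expand : ∀ x → (c +F d) +F x *F (eval cs l x +F eval ds l′ x) ≡ eval (c ∷ cs) l x +F eval (d ∷ ds) l′ x
    expand x = solve 5 (λ c d x u v → (c :+ d) :+ x :* (u :+ v) := (c :+ x :* u) :+ (d :+ x :* v))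
      refl c d x (eval cs l x) (eval ds l′ x)

  +-isPolynomial : ∀ {l′} → IsPolynomial n l f → IsPolynomial n l′ g →
                   IsPolynomial n (l +F l′) (λ x → f x +F g x)
  +-isPolynomial (cs , refl , eval≗f) (ds , len , eval≗g) =
    isPolynomial-resp (λ x → cong₂ _+F_ (eval≗f x) (eval≗g x)) (+-eval cs ds (sym len))

  factor-eval : ∀ c cs a → Σ[ g ∈ (Carrier → Carrier) ] IsPolynomial (length cs) l g ×
                (∀ x → eval (c ∷ cs) l x ≡ (x -F a) *F g x +F eval (c ∷ cs) l a)
  factor-eval {l = l} c [] a = (λ _ → l) , eval-isPolynomial [] , λ x →
    solve 4 (λ c l x a → c :+ x :* l := (x :- a) :* l :+ (c :+ a :* l)) refl c l x a
  factor-eval {l = l} c (c′ ∷ cs) a with factor-eval c′ cs a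
  ... | g , g-poly , h≡ = (λ x → h a +F x *F g x) , ∷-isPolynomial (h a) g-poly , λ x → begin
    c +F x *F h x
      ≡⟨ cong (λ y → c +F x *F y) (h≡ x) ⟩
    c +F x *F ((x -F a) *F g x +F h a)
      ≡⟨ solve 5 (λ c x a g h → c :+ x :* ((x :- a) :* g :+ h) := (x :- a) :* (h :+ x :* g) :+ (c :+ a :* h))
                 refl c x a (g x) (h a) ⟩
    (x -F a) *F (h a +F x *F g x) +F (c +F a *F h a) ∎
    where
    h : Carrier → Carrier
    h = eval (c′ ∷ cs) l

  factor-isPolynomial : IsPolynomial (suc n) l f → ∀ a → Σ[ g ∈ (Carrier → Carrier) ]
                        IsPolynomial n l g × (∀ x → f x ≡ (x -F a) *F g x +F f a)
  factor-isPolynomial {f = f} (c ∷ cs , refl , eval≗f) a with factor-eval c cs a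
  ... | g , g-poly , eval≡ = g , g-poly , λ x → begin
    f x                                          ≡⟨ eval≗f x ⟨
    eval (c ∷ cs) _ x                            ≡⟨ eval≡ x ⟩
    (x -F a) *F g x +F eval (c ∷ cs) _ a         ≡⟨ cong ((x -F a) *F g x +F_) (eval≗f a) ⟩
    (x -F a) *F g x +F f a                       ∎

  roots≤degree : ∀ {xs} → IsPolynomial n l f → ¬ l ≡ 0F → Unique xs →
                 (∀ {x} → x ∈ xs → f x ≡ 0F) → length xs ≤ n
  roots≤degree {xs = []} _ _ _ _ = z≤n
  roots≤degree {xs = a ∷ xs} ([] , refl , eval≗f) l≢0 _ roots =
    ⊥-elim (l≢0 (trans (eval≗f a) (roots (here refl))))
  roots≤degree {f = f} {xs = a ∷ xs} poly@(_ ∷ _ , refl , _) l≢0 (a∉xs ∷ xs-unique) roots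
    with factor-isPolynomial poly a
  ... | g , g-poly , f≡ = s≤s (roots≤degree g-poly l≢0 xs-unique g-root)
    where
    g-root : ∀ {y} → y ∈ xs → g y ≡ 0F
    g-root {y} y∈xs = x≢0∧x*y≡0⇒y≡0 y-a≢0 (begin
      (y -F a) *F g y         ≡⟨ +-identityʳ _ ⟨
      (y -F a) *F g y +F 0F   ≡⟨ cong ((y -F a) *F g y +F_) (roots (here refl)) ⟨
      (y -F a) *F g y +F f a  ≡⟨ f≡ y ⟨
      f y                     ≡⟨ roots (there y∈xs) ⟩
      0F                      ∎)
      where
      y-a≢0 : ¬ y -F a ≡ 0F
      y-a≢0 y-a≡0 = All.lookup a∉xs y∈xs (sym (x-y≡0⇒x≡y y-a≡0))

  -- The Frobenius map

  p∣m⇒m·x≡0 : ∀ {p m} → p ×1 ≡ 0F → p ∣ m → ∀ x → m · x ≡ 0F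
  p∣m⇒m·x≡0 {p} char (divides c refl) x = begin
    (c * p) · x                  ≡⟨ cong ((c * p) ·_) (*-identityˡ x) ⟨
    (c * p) · (1F *F x)          ≡⟨ Mult.×-assoc-* (c * p) 1F x ⟨
    ((c * p) · 1F) *F x          ≡⟨ cong (_*F x) (Mult.×1-homo-* c p) ⟩
    ((c · 1F) *F (p · 1F)) *F x  ≡⟨ cong (λ z → ((c · 1F) *F z) *F x) (trans (sym (×1≗·1F p)) char) ⟩
    ((c · 1F) *F 0F) *F x        ≡⟨ cong (_*F x) (zeroʳ _) ⟩
    0F *F x                      ≡⟨ zeroˡ x ⟩
    0F                           ∎

  frobenius : ∀ {p} → Prime p → p ×1 ≡ 0F → ∀ x y → (x +F y) ^F p ≡ x ^F p +F y ^F p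
  frobenius {zero}  p-prime = ⊥-elim (¬prime[0] p-prime)
  frobenius {suc n} p-prime char x y = begin
    (x +F y) ^F suc n                                 ≡⟨ ^F≗^′ (x +F y) (suc n) ⟩
    (x +F y) ^′ suc n                                 ≡⟨ Binomial.theorem commutativeSemiring (suc n) x y ⟩
    t Fin.zero +F sum (λ i → t (Fin.suc i))
      ≡⟨ cong (t Fin.zero +F_) (sum-init-last (λ i → t (Fin.suc i))) ⟩
    t Fin.zero +F (sum (λ i → t (Fin.suc (inject₁ i))) +F t (Fin.suc (fromℕ n)))
      ≡⟨ cong (λ z → t Fin.zero +F (z +F t (Fin.suc (fromℕ n)))) inner-terms-vanish ⟩
    t Fin.zero +F (0F +F t (Fin.suc (fromℕ n)))       ≡⟨ cong₂ (λ u v → u +F (0F +F v)) first-term last-term ⟩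
    y ^F suc n +F (0F +F x ^F suc n)                  ≡⟨ cong (y ^F suc n +F_) (+-identityˡ _) ⟩
    y ^F suc n +F x ^F suc n                          ≡⟨ +-comm _ _ ⟩
    x ^F suc n +F y ^F suc n                          ∎
    where
    open MonoidSum +-monoid using (sum; sum-init-last; sum-cong-≗; sum-replicate-zero)
    t : Fin (suc (suc n)) → Carrier
    t = Binomial.binomialTerm commutativeSemiring x y (suc n)
    inner-terms-vanish : sum (λ i → t (Fin.suc (inject₁ i))) ≡ 0F
    inner-terms-vanish = trans (sum-cong-≗ λ i → p∣m⇒m·x≡0 char (p∣pCi i) _) (sum-replicate-zero n)
      where
      p∣pCi : ∀ i → suc n ∣ suc n C suc (toℕ (inject₁ i))
      p∣pCi i = prime∣pCk p-prime (s≤s z≤n) (s≤s (subst (_< n) (sym (toℕ-inject₁ i)) (toℕ<n i)))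
    first-term : t Fin.zero ≡ y ^F suc n
    first-term = trans (trans (+-identityʳ _) (*-identityˡ _)) (sym (^F≗^′ y (suc n)))
    last-term : t (Fin.suc (fromℕ n)) ≡ x ^F suc n
    last-term = begin
      (suc n C suc (toℕ (fromℕ n))) · (x ^′ suc (toℕ (fromℕ n)) *F y ^′ (n ∸ toℕ (fromℕ n)))
        ≡⟨ cong (λ k → (suc n C suc k) · (x ^′ suc k *F y ^′ (n ∸ k))) (toℕ-fromℕ n) ⟩
      (suc n C suc n) · (x ^′ suc n *F y ^′ (n ∸ n))
        ≡⟨ cong₂ (λ c k → c · (x ^′ suc n *F y ^′ k)) (nCn≡1 (suc n)) (ℕ.n∸n≡0 n) ⟩
      1 · (x ^′ suc n *F 1F)   ≡⟨ trans (+-identityʳ _) (*-identityʳ _) ⟩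
      x ^′ suc n               ≡⟨ ^F≗^′ x (suc n) ⟨
      x ^F suc n               ∎

  0^F-prime : ∀ {p} → Prime p → 0F ^F p ≡ 0F
  0^F-prime {zero}  p-prime = ⊥-elim (¬prime[0] p-prime)
  0^F-prime {suc n} _       = zeroˡ _

  frobenius-sub : ∀ {p} → Prime p → p ×1 ≡ 0F → ∀ x y → (x -F y) ^F p ≡ x ^F p -F y ^F p
  frobenius-sub {p} p-prime char x y = begin
    (x -F y) ^F p            ≡⟨ frobenius p-prime char x (-F y) ⟩
    x ^F p +F (-F y) ^F p    ≡⟨ cong (x ^F p +F_) [-y]^p≡-y^p ⟩
    x ^F p -F y ^F p         ∎
    where
    [-y]^p≡-y^p : (-F y) ^F p ≡ -F (y ^F p)
    [-y]^p≡-y^p = begin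
      (-F y) ^F p                               ≡⟨ solve 2 (λ u v → v := (u :+ v) :- u) refl (y ^F p) ((-F y) ^F p) ⟩
      (y ^F p +F (-F y) ^F p) -F y ^F p         ≡⟨ cong (_-F y ^F p) (frobenius p-prime char y (-F y)) ⟨
      (y -F y) ^F p -F y ^F p                   ≡⟨ cong (λ z → z ^F p -F y ^F p) (-‿inverseʳ y) ⟩
      0F ^F p -F y ^F p                         ≡⟨ cong (_-F y ^F p) (0^F-prime p-prime) ⟩
      0F -F y ^F p                              ≡⟨ +-identityˡ _ ⟩
      -F (y ^F p)                               ∎

  -- The eliminant of x^p x^r = d and (x^p − 1)(x − 1)^r = c with respect to x^p.
  Φ : ℕ → Carrier → Carrier → Carrier → Carrier
  Φ r c d x = x ^F r *F (x -F 1F) ^F r +F (c *F x ^F r -F d *F (x -F 1F) ^F r)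

  Φ-isPolynomial : ∀ {r} c d → 0 < r → IsPolynomial (r + r) 1F (Φ r c d)
  Φ-isPolynomial {r} c d 0<r =
    subst₂ (λ n l → IsPolynomial n l (Φ r c d)) (cong (r +_) (ℕ.+-identityʳ r)) (+-identityʳ 1F)
      (isPolynomial-resp expand (+-isPolynomial leading (raise-<-isPolynomial (ℕ.m<n+m (r + 0) 0<r) lower)))
    where
    leading : IsPolynomial (r + (r + 0)) 1F (λ x → (x +F 0F) ^F r *F ((x -F 1F) ^F r *F 1F))
    leading = *-linear^-isPolynomial r 0F (*-linear^-isPolynomial r (-F 1F) (eval-isPolynomial {l = 1F} []))
    lower : IsPolynomial (r + 0) (c +F -F d) (λ x → (x +F 0F) ^F r *F c +F (x -F 1F) ^F r *F -F d)
    lower = +-isPolynomial (*-linear^-isPolynomial r 0F (eval-isPolynomial {l = c} []))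
                           (*-linear^-isPolynomial r (-F 1F) (eval-isPolynomial {l = -F d} []))
    expand : ∀ x → (x +F 0F) ^F r *F ((x -F 1F) ^F r *F 1F) +F ((x +F 0F) ^F r *F c +F (x -F 1F) ^F r *F -F d)
                   ≡ Φ r c d x
    expand x = begin
      (x +F 0F) ^F r *F ((x -F 1F) ^F r *F 1F) +F ((x +F 0F) ^F r *F c +F (x -F 1F) ^F r *F -F d)
        ≡⟨ cong₂ (λ R S → R *F S +F (R *F c +F (x -F 1F) ^F r *F -F d))
                 (cong (_^F r) (+-identityʳ x)) (*-identityʳ _) ⟩
      x ^F r *F (x -F 1F) ^F r +F (x ^F r *F c +F (x -F 1F) ^F r *F -F d)
        ≡⟨ solve 4 (λ R S c d → R :* S :+ (R :* c :+ S :* (:- d)) := R :* S :+ (c :* R :- d :* S))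
                 refl (x ^F r) ((x -F 1F) ^F r) c d ⟩
      Φ r c d x ∎

  Φ-root : ∀ {p} → Prime p → p ×1 ≡ 0F → ∀ {r c d x} →
           x ^F (p + r) ≡ d → (x -F 1F) ^F (p + r) ≡ c → Φ r c d x ≡ 0F
  Φ-root {p} p-prime char {r} {c} {d} {x} x^k≡d [x-1]^k≡c = begin
    Φ r c d x                              ≡⟨ cong₂ (λ c d → R *F S +F (c *F R -F d *F S)) c≡ d≡ ⟩
    R *F S +F ((X -F 1F) *F S *F R -F X *F R *F S)
      ≡⟨ solve 4 (λ R S X o → R :* S :+ ((X :- o) :* S :* R :- X :* R :* S) := R :* S :- R :* S :* o)
                 refl R S X 1F ⟩
    R *F S -F R *F S *F 1F                 ≡⟨ cong (λ z → R *F S -F z) (*-identityʳ _) ⟩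
    R *F S -F R *F S                       ≡⟨ -‿inverseʳ _ ⟩
    0F                                     ∎
    where
    X R S : Carrier
    X = x ^F p
    R = x ^F r
    S = (x -F 1F) ^F r
    d≡ : d ≡ X *F R
    d≡ = trans (sym x^k≡d) (^F-homo-* x p r)
    c≡ : c ≡ (X -F 1F) *F S
    c≡ = begin
      c                              ≡⟨ [x-1]^k≡c ⟨
      (x -F 1F) ^F (p + r)           ≡⟨ ^F-homo-* (x -F 1F) p r ⟩
      (x -F 1F) ^F p *F S            ≡⟨ cong (_*F S) (frobenius-sub p-prime char x 1F) ⟩
      (X -F 1F ^F p) *F S            ≡⟨ cong (λ z → (X -F z) *F S) (1^F p) ⟩
      (X -F 1F) *F S                 ∎

  solutions≤r+r : ∀ {p} → Prime p → p ×1 ≡ 0F → ∀ {r} c d → 0 < r → ∀ {xs} → Unique xs →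
               (∀ {x} → x ∈ xs → x ^F (p + r) ≡ d × (x -F 1F) ^F (p + r) ≡ c) → length xs ≤ r + r
  solutions≤r+r p-prime char c d 0<r xs-unique sols =
    roots≤degree (Φ-isPolynomial c d 0<r) (λ 1≡0 → 0≢1 (sym 1≡0)) xs-unique
      (λ x∈xs → Φ-root p-prime char (proj₁ (sols x∈xs)) (proj₂ (sols x∈xs)))

  -- Fermat's little theorem

  elements : List Carrier
  elements = map (Inverse.to enum) (allFin q)

  elements-unique : Unique elements
  elements-unique = Unique.map⁺ (Injection.injective (↔⇒↣ enum)) (Unique.allFin⁺ q)

  ∈-elements : ∀ x → x ∈ elements
  ∈-elements x = subst (_∈ elements) (Inverse.strictlyInverseˡ enum x)
    (∈-map⁺ (Inverse.to enum) (∈-allFin (Inverse.from enum x)))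

  units : List Carrier
  units = filter (λ x → ¬? (x ≟ 0F)) elements

  units-unique : Unique units
  units-unique = Unique.filter⁺ _ elements-unique

  ∈-units : ∀ {x} → ¬ x ≡ 0F → x ∈ units
  ∈-units {x} x≢0 = ∈-filter⁺ _ (∈-elements x) x≢0

  ∈-units⇒≢0 : ∀ {x} → x ∈ units → ¬ x ≡ 0F
  ∈-units⇒≢0 x∈units = proj₂ (∈-filter⁻ _ {xs = elements} x∈units)

  length-units : length units ≡ q ∸ 1
  length-units = begin
    length (0F ∷ units) ∸ 1  ≡⟨ cong (_∸ 1) (↭-length elements↭0∷units) ⟨
    length elements ∸ 1      ≡⟨ cong (_∸ 1) (length-map (Inverse.to enum) (allFin q)) ⟩
    length (allFin q) ∸ 1    ≡⟨ cong (_∸ 1) (length-tabulate {n = q} (λ i → i)) ⟩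
    q ∸ 1                    ∎
    where
    elements↭0∷units : elements ↭ 0F ∷ units
    elements↭0∷units = ∼bag⇒↭ (unique∧set⇒bag elements-unique
      (All.tabulate (λ x∈units 0≡x → ∈-units⇒≢0 x∈units (sym 0≡x)) ∷ units-unique)
      (λ {x} → mk⇔ (λ _ → zero-or-unit x) (λ _ → ∈-elements x)))
      where
      zero-or-unit : ∀ x → x ∈ 0F ∷ units
      zero-or-unit x with x ≟ 0F
      ... | yes x≡0 = here x≡0
      ... | no x≢0  = there (∈-units x≢0)

  *-units↭units : ∀ {a} → ¬ a ≡ 0F → map (a *F_) units ↭ units
  *-units↭units {a} a≢0 = ∼bag⇒↭ (unique∧set⇒bag (Unique.map⁺ *-injective units-unique) units-unique
    (mk⇔ image⊆units units⊆image))
    where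
    *-injective : ∀ {x y} → a *F x ≡ a *F y → x ≡ y
    *-injective {x} {y} ax≡ay = x-y≡0⇒x≡y (x≢0∧x*y≡0⇒y≡0 a≢0 (begin
      a *F (x -F y)        ≡⟨ solve 3 (λ a x y → a :* (x :- y) := a :* x :- a :* y) refl a x y ⟩
      a *F x -F a *F y     ≡⟨ cong (_-F a *F y) ax≡ay ⟩
      a *F y -F a *F y     ≡⟨ -‿inverseʳ _ ⟩
      0F                   ∎))
    image⊆units : ∀ {x} → x ∈ map (a *F_) units → x ∈ units
    image⊆units x∈image with ∈-map⁻ (a *F_) x∈image
    ... | y , y∈units , refl = ∈-units (λ ay≡0 → ∈-units⇒≢0 y∈units (x≢0∧x*y≡0⇒y≡0 a≢0 ay≡0))
    units⊆image : ∀ {x} → x ∈ units → x ∈ map (a *F_) units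
    units⊆image {x} x∈units with inverse a a≢0
    ... | a⁻¹ , aa⁻¹≡1 = subst (_∈ map (a *F_) units) a[a⁻¹x]≡x (∈-map⁺ (a *F_) (∈-units a⁻¹x≢0))
      where
      a[a⁻¹x]≡x : a *F (a⁻¹ *F x) ≡ x
      a[a⁻¹x]≡x = trans (sym (*-assoc a a⁻¹ x)) (trans (cong (_*F x) aa⁻¹≡1) (*-identityˡ x))
      a⁻¹x≢0 : ¬ a⁻¹ *F x ≡ 0F
      a⁻¹x≢0 a⁻¹x≡0 = ∈-units⇒≢0 x∈units (trans (sym a[a⁻¹x]≡x) (trans (cong (a *F_) a⁻¹x≡0) (zeroʳ a)))

  product : List Carrier → Carrier
  product = foldr _*F_ 1F

  product-↭ : ∀ {xs ys} → xs ↭ ys → product xs ≡ product ys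
  product-↭ xs↭ys =
    PermutationProperties.foldr-commMonoid (setoid Carrier) *-isCommutativeMonoid (↭⇒↭ₛ xs↭ys)

  product-map-* : ∀ a xs → product (map (a *F_) xs) ≡ a ^F length xs *F product xs
  product-map-* a []       = sym (*-identityˡ 1F)
  product-map-* a (x ∷ xs) = begin
    a *F x *F product (map (a *F_) xs)         ≡⟨ cong (a *F x *F_) (product-map-* a xs) ⟩
    a *F x *F (a ^F length xs *F product xs)   ≡⟨ solve 4 (λ a x b c → a :* x :* (b :* c) := a :* b :* (x :* c))
                                                    refl a x (a ^F length xs) (product xs) ⟩
    a *F a ^F length xs *F (x *F product xs)   ∎

  product-≢0 : ∀ xs → All (λ x → ¬ x ≡ 0F) xs → ¬ product xs ≡ 0F
  product-≢0 []       _                  1≡0 = 0≢1 (sym 1≡0)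
  product-≢0 (x ∷ xs) (x≢0 All.∷ xs≢0) xxs≡0 = product-≢0 xs xs≢0 (x≢0∧x*y≡0⇒y≡0 x≢0 xxs≡0)

  -- Multiplying all units by a permutes them, so a^(q−1) ∏ units = ∏ units.
  fermat : ∀ {a} → ¬ a ≡ 0F → a ^F (q ∸ 1) ≡ 1F
  fermat {a} a≢0 = subst (λ n → a ^F n ≡ 1F) length-units (x-y≡0⇒x≡y
    (x≢0∧x*y≡0⇒y≡0 (product-≢0 units (All.tabulate ∈-units⇒≢0)) (begin
      P *F (A -F 1F)                    ≡⟨ solve 3 (λ P A o → P :* (A :- o) := A :* P :- P :* o) refl P A 1F ⟩
      A *F P -F P *F 1F                 ≡⟨ cong₂ _-F_ (sym (product-map-* a units)) (*-identityʳ P) ⟩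
      product (map (a *F_) units) -F P  ≡⟨ cong (_-F P) (product-↭ (*-units↭units a≢0)) ⟩
      P -F P                            ≡⟨ -‿inverseʳ P ⟩
      0F                                ∎)))
    where
    P A : Carrier
    P = product units
    A = a ^F length units

  InC⇒^k : ∀ {α x} e k a → ¬ α ≡ 0F → e * k ≡ q ∸ 1 → InC α e a x → x ^F k ≡ (α ^F a) ^F k
  InC⇒^k {α} e k a α≢0 e*k≡q-1 (j , refl) = begin
    (β ^F j *F α ^F a) ^F k              ≡⟨ ^F-distrib-* (β ^F j) (α ^F a) k ⟩
    (β ^F j) ^F k *F (α ^F a) ^F k       ≡⟨ cong (_*F (α ^F a) ^F k) [β^j]^k≡1 ⟩
    1F *F (α ^F a) ^F k                  ≡⟨ *-identityˡ _ ⟩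
    (α ^F a) ^F k                        ∎
    where
    β : Carrier
    β = α ^F e
    [β^j]^k≡1 : (β ^F j) ^F k ≡ 1F
    [β^j]^k≡1 = begin
      (β ^F j) ^F k        ≡⟨ ^F-assocʳ β j k ⟩
      β ^F (j * k)         ≡⟨ cong (β ^F_) (ℕ.*-comm j k) ⟩
      β ^F (k * j)         ≡⟨ ^F-assocʳ β k j ⟨
      (β ^F k) ^F j        ≡⟨ cong (_^F j) (trans (^F-assocʳ α e k) (cong (α ^F_) e*k≡q-1)) ⟩
      (α ^F (q ∸ 1)) ^F j  ≡⟨ cong (_^F j) (fermat α≢0) ⟩
      1F ^F j              ≡⟨ 1^F j ⟩
      1F                   ∎

proposition5p1 : (p q n : ℕ) → Prime p → 1 ≤ n → q ≡ p ^ n →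
    (F : FiniteField q) → FiniteField._×1 F p ≡ FiniteField.0F F →
    (k e : ℕ) → 1 ≤ k → k ∣ (q ∸ 1) → e * k ≡ q ∸ 1 →
    (α : FiniteField.Carrier F) → FiniteField.IsPrimitive F α →
    3 * k ≤ 4 * p → p < k →
    ∀ a b → a < e → b < e → ∀ m →
    FiniteField.CyclotomicNumber F α e a b m → m ≤ k / 2
proposition5p1 p q n p-prime _ _ F char k e _ _ e*k≡q-1 α (α≢0 , _) 3k≤4p p<k a b _ _ _
               (xs , xs-unique , refl , ∈xs⇔) =
  ℕ.≤-trans
    (solutions≤r+r p-prime char ((α ^F a) ^F k) ((α ^F b) ^F k) (ℕ.m<n⇒0<n∸m p<k) xs-unique solution)
    ([k∸p]+[k∸p]≤k/2 3k≤4p p<k)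
  where
  open FiniteField F
  open FiniteFieldProperties F
  p+[k∸p]≡k : p + (k ∸ p) ≡ k
  p+[k∸p]≡k = ℕ.m+[n∸m]≡n (ℕ.<⇒≤ p<k)
  solution : ∀ {x} → x ∈ xs →
             x ^F (p + (k ∸ p)) ≡ (α ^F b) ^F k × (x -F 1F) ^F (p + (k ∸ p)) ≡ (α ^F a) ^F k
  solution x∈xs with Equivalence.to (∈xs⇔ _) x∈xs
  ... | x∈Cb , (y , y∈Ca , refl) =
    trans (cong (_ ^F_) p+[k∸p]≡k) (InC⇒^k e k b α≢0 e*k≡q-1 x∈Cb) ,
    trans (cong₂ _^F_ (x+y-y≡x y 1F) p+[k∸p]≡k) (InC⇒^k e k a α≢0 e*k≡q-1 y∈Ca)
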